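{- For every integer $k\ge 1$, $2\le \chi_{la}\big(\sum_{i=1}^k C^i_8\big)\le 4$, where $\sum_{i=1}^k C^i_8$ denotes the disjoint union of $k$ copies $C^1_8,\dots,C^k_8$ of the graph $C_8^*$ described below.
   Context: For a graph $G=(V,E)$ with $|E|=m$ and no isolated vertices, a local antimagic labeling is a bijection $f:E\to\{1,\dots,m\}$ such that $f^+(u)\ne f^+(v)$ for every edge $uv$, where $f^+(x)=\sum f(e)$ over all edges $e$ incident to $x$. The local antimagic chromatic number $\chi_{la}(G)$ is the minimum, over all local antimagic labelings $f$ of $G$, of the number of distinct values taken by $f^+$ (also for disconnected graphs). $C_8^*$ is the graph consisting of an 8-cycle $u_1u_2\cdots u_8u_1$ together with one additional vertex $x$ adjacent to $u_2$ and $u_6$ (9 vertices, 10 edges). -}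

module Defs where

open import Data.Nat using (ℕ; zero; suc; _+_; _*_; _≤_)
open import Data.Nat.Properties using (_≟_)
open import Data.Fin using (Fin; toℕ; combine; remQuot)
open import Data.Fin.Patterns
import Data.Fin.Properties as FinP
open import Data.List using (List; length; map; deduplicate; allFin)
open import Data.Nat.ListAction using (sum)
open import Data.Product using (_×_; _,_; proj₁; proj₂)
open import Data.Bool using (Bool; if_then_else_; _∨_)
open import Relation.Nullary using (¬_)
open import Relation.Nullary.Decidable using (⌊_⌋)
open import Relation.Binary.PropositionalEquality using (_≡_)
open import Function.Definitions using (Bijective)

record Graph (n m : ℕ) : Set where
  field
    ends : Fin m → Fin n × Fin n

open Graph public

-- An edge labeling is a bijection f : Fin m → Fin m; edge e gets label
-- toℕ (f e) + 1, so this is a bijection E → {1, …, m}.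
label : ∀ {m} → (Fin m → Fin m) → Fin m → ℕ
label f e = suc (toℕ (f e))

incident : ∀ {n m} → Graph n m → Fin m → Fin n → Bool
incident G e v = ⌊ proj₁ (ends G e) FinP.≟ v ⌋ ∨ ⌊ proj₂ (ends G e) FinP.≟ v ⌋

vsum : ∀ {n m} → Graph n m → (Fin m → Fin m) → Fin n → ℕ
vsum G f v = sum (map (λ e → if incident G e v then label f e else 0) (allFin _))

IsLocalAntimagic : ∀ {n m} → Graph n m → (Fin m → Fin m) → Set
IsLocalAntimagic {n} {m} G f =
  Bijective {A = Fin m} {B = Fin m} _≡_ _≡_ f ×
  (∀ e → ¬ (vsum G f (proj₁ (ends G e)) ≡ vsum G f (proj₂ (ends G e))))

numColours : ∀ {n m} → Graph n m → (Fin m → Fin m) → ℕ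
numColours G f = length (deduplicate _≟_ (map (vsum G f) (allFin _)))

-- C₈*: vertices u₁,…,u₈ are 0,…,7 and x is 8.
-- Edges: uᵢuᵢ₊₁ (i = 1..8, indices mod 8), x u₂, x u₆.
C8*ends : Fin 10 → Fin 9 × Fin 9
C8*ends 0F = 0F , 1F
C8*ends 1F = 1F , 2F
C8*ends 2F = 2F , 3F
C8*ends 3F = 3F , 4F
C8*ends 4F = 4F , 5F
C8*ends 5F = 5F , 6F
C8*ends 6F = 6F , 7F
C8*ends 7F = 7F , 0F
C8*ends 8F = 8F , 1F
C8*ends 9F = 8F , 5F

C8* : Graph 9 10
C8* = record { ends = C8*ends }

copies : ∀ {n m} (k : ℕ) → Graph n m → Graph (k * n) (k * m)
copies {n} {m} k G = record { ends = λ e →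
  let (i , j) = remQuot {k} m e
  in combine i (proj₁ (ends G j)) , combine i (proj₂ (ends G j)) }

{-# OPTIONS --safe #-}

-- Number the copies i = 0, …, K - 1 and cut the labels 1, …, 10K into eight blocks of K
-- consecutive labels, one for each cycle edge, and the top 2K labels, shared by the two edges
-- at x. In copy i a cycle edge with block b gets Kb + i + 1 or Kb + K - i, and the edges xu₂, xu₆
-- get 8K + 2(K - 1 - i) + 1 and 8K + 2i + 2. The orientations are chosen so that at every vertex
-- the contributions growing with i cancel those shrinking with i: every copy has the vertex sums
-- 8K + 1, 12K + 1, 14K + 2 and 18K + 1, and adjacent vertices get different ones. Conversely,
-- the two ends of any edge carry distinct vertex sums, so at least two values occur.

module Submission where

open import Defs
open import Data.Bool using (Bool; true; false; if_then_else_; _∨_)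
open import Data.Fin using (Fin; toℕ; combine; remQuot; opposite; cast; splitAt; punchIn; _↑ˡ_; _↑ʳ_)
open import Data.Fin.Patterns
open import Data.Fin.Properties as Fin
  using (*↔×; +↔⊎; toℕ-cast; toℕ-combine; toℕ-↑ˡ; toℕ-↑ʳ; remQuot-combine; combine-remQuot;
         combine-injectiveˡ; combine-injectiveʳ; punchInᵢ≢i; opposite-involutive; opposite-prop;
         cast-involutive; toℕ≤pred[n])
open import Data.List using (List; []; _∷_; length; map; filter; tabulate; allFin; deduplicate)
open import Data.List.Membership.Propositional using (_∈_)
open import Data.List.Membership.Propositional.Properties
  using (∈-filter⁺; ∈-map⁺; ∈-map⁻; ∈-deduplicate⁺; ∈-deduplicate⁻; ∈-allFin)
open import Data.List.Properties using (filter-notAll; map-tabulate; map-cong)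
open import Data.List.Relation.Binary.Subset.Propositional using (_⊆_)
import Data.List.Relation.Unary.All as All
import Data.List.Relation.Unary.AllPairs as AllPairs
open import Data.List.Relation.Unary.Any as Any using (here; there)
open import Data.List.Relation.Unary.Unique.Propositional using (Unique)
open import Data.List.Relation.Unary.Unique.DecPropositional.Properties using (deduplicate-!)
open import Data.Nat using (ℕ; zero; suc; _+_; _*_; _≤_; _<_; z≤n; s≤s)
open import Data.Nat.ListAction using (sum)
open import Data.Nat.Properties
  using (_≟_; +-0-commutativeMonoid; +-assoc; +-identityʳ; ≤-trans; *-comm; *-distribˡ-+;
         <⇒≢; >⇒≢; m<m+n; m+[n∸m]≡n)
open import Data.Nat.Tactic.RingSolver using (solve)
open import Data.Product using (_×_; Σ; _,_; proj₁; proj₂)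
open import Data.Product.Algebra using (×-comm; ×-distribˡ-⊎)
open import Data.Product.Function.Dependent.Propositional using (Σ-↔)
open import Data.Product.Function.NonDependent.Propositional using (_×-↔_)
open import Data.Sum using (_⊎_; inj₁; inj₂; [_,_]′)
open import Data.Sum.Function.Propositional using (_⊎-↔_)
open import Function.Base using (_∘_; _∋_; id)
open import Function.Bundles using (Inverse; Bijection; _↔_; mk↔ₛ′; mk⇔)
open import Function.Construct.Composition using (_↔-∘_)
open import Function.Properties.Inverse using (↔-refl; ↔-sym; Inverse⇒Bijection)
open import Function.Related.Propositional using (bijection; module EquationalReasoning)
open import Relation.Binary.Definitions using (DecidableEquality)
open import Relation.Binary.PropositionalEquality
  using (_≡_; _≢_; refl; sym; trans; cong; cong₂; subst; _≗_; module ≡-Reasoning)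
open import Relation.Nullary using (¬?)
open import Relation.Nullary.Decidable using (⌊_⌋; isYes≗does; does-⇔; dec-false)

open import Algebra.Properties.CommutativeMonoid.Sum +-0-commutativeMonoid
  using (sum-cong-≗; sum-replicate-zero; sum-remove) renaming (sum to ∑)

private variable
  k m n : ℕ

sum-map-allFin : (h : Fin n → ℕ) → sum (map h (allFin n)) ≡ ∑ h
sum-map-allFin h = trans (cong sum (map-tabulate id h)) (sum-tabulate h)
  where
  sum-tabulate : (h : Fin n → ℕ) → sum (tabulate h) ≡ ∑ h
  sum-tabulate {zero}  h = refl
  sum-tabulate {suc n} h = cong (h 0F +_) (sum-tabulate (h ∘ Fin.suc))

∑-zero : {h : Fin n → ℕ} → (∀ i → h i ≡ 0) → ∑ h ≡ 0
∑-zero {n} h≗0 = trans (sum-cong-≗ h≗0) (sum-replicate-zero n)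

∑-single : {h : Fin n → ℕ} (i : Fin n) → (∀ j → j ≢ i → h j ≡ 0) → ∑ h ≡ h i
∑-single {suc n} {h} i h≗0 = begin
  ∑ h                      ≡⟨ sum-remove {i = i} h ⟩
  h i + ∑ (h ∘ punchIn i)  ≡⟨ cong (h i +_) (∑-zero (λ j → h≗0 (punchIn i j) (punchInᵢ≢i i j))) ⟩
  h i + 0                  ≡⟨ +-identityʳ (h i) ⟩
  h i                      ∎
  where open ≡-Reasoning

∑-split : ∀ m {n} (h : Fin (m + n) → ℕ) → ∑ h ≡ ∑ (h ∘ (_↑ˡ n)) + ∑ (h ∘ (m ↑ʳ_))
∑-split zero    h = refl
∑-split (suc m) h = trans (cong (h 0F +_) (∑-split m (h ∘ Fin.suc))) (sym (+-assoc (h 0F) _ _))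

∑-combine : ∀ k {m} (h : Fin (k * m) → ℕ) →
  ∑ h ≡ ∑ (λ (i : Fin k) → ∑ (λ (j : Fin m) → h (combine i j)))
∑-combine zero        h = refl
∑-combine (suc k) {m} h =
  trans (∑-split m h) (cong (∑ (λ j → h (j ↑ˡ k * m)) +_) (∑-combine k (h ∘ (m ↑ʳ_))))

-- vsum G f is, definitionally, incidenceSum G (label f).
incidenceSum : Graph n m → (Fin m → ℕ) → Fin n → ℕ
incidenceSum G w v = sum (map (λ e → if incident G e v then w e else 0) (allFin _))

incidenceSum-cong : (G : Graph n m) {w w′ : Fin m → ℕ} → w ≗ w′ →
  ∀ v → incidenceSum G w v ≡ incidenceSum G w′ v
incidenceSum-cong G w≗w′ v =
  cong sum (map-cong (λ e → cong (if incident G e v then_else 0) (w≗w′ e)) (allFin _))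

⌊combine≟combine⌋ : (i : Fin k) (a b : Fin n) → ⌊ combine i a Fin.≟ combine i b ⌋ ≡ ⌊ a Fin.≟ b ⌋
⌊combine≟combine⌋ i a b =
  trans (isYes≗does (combine i a Fin.≟ combine i b))
    (trans (does-⇔ (mk⇔ (combine-injectiveʳ i a i b) (cong (combine i)))
                   (combine i a Fin.≟ combine i b) (a Fin.≟ b))
           (sym (isYes≗does (a Fin.≟ b))))

⌊combine≟combine⌋-≢ : {i i′ : Fin k} → i ≢ i′ → (a b : Fin n) →
  ⌊ combine i a Fin.≟ combine i′ b ⌋ ≡ false
⌊combine≟combine⌋-≢ {i = i} {i′} i≢i′ a b =
  trans (isYes≗does (combine i a Fin.≟ combine i′ b))
        (dec-false (combine i a Fin.≟ combine i′ b) (i≢i′ ∘ combine-injectiveˡ i a i′ b))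

module _ (k : ℕ) (G : Graph n m) where

  incident-copies : (i : Fin k) (j : Fin m) (v : Fin (k * n)) →
    incident (copies k G) (combine i j) v
      ≡ ⌊ combine i (proj₁ (ends G j)) Fin.≟ v ⌋ ∨ ⌊ combine i (proj₂ (ends G j)) Fin.≟ v ⌋
  incident-copies i j v =
    cong (λ (i , j) → ⌊ combine i (proj₁ (ends G j)) Fin.≟ v ⌋ ∨ ⌊ combine i (proj₂ (ends G j)) Fin.≟ v ⌋)
         (remQuot-combine i j)

  incidenceSum-copies : (w : Fin (k * m) → ℕ) (i : Fin k) (v : Fin n) →
    incidenceSum (copies k G) w (combine i v) ≡ incidenceSum G (w ∘ combine i) v
  incidenceSum-copies w i v = begin
    incidenceSum (copies k G) w (combine i v)
      ≡⟨ sum-map-allFin term ⟩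
    ∑ term
      ≡⟨ ∑-combine k term ⟩
    ∑ (λ (i′ : Fin k) → ∑ (λ (j : Fin m) → term (combine i′ j)))
      ≡⟨ ∑-single i (λ i′ i′≢i → ∑-zero (other-copy i′≢i)) ⟩
    ∑ (λ (j : Fin m) → term (combine i j))
      ≡⟨ sum-cong-≗ same-copy ⟩
    ∑ (λ (j : Fin m) → if incident G j v then w (combine i j) else 0)
      ≡⟨ sum-map-allFin (λ j → if incident G j v then w (combine i j) else 0) ⟨
    incidenceSum G (w ∘ combine i) v
      ∎
    where
    open ≡-Reasoning
    term : Fin (k * m) → ℕ
    term e = if incident (copies k G) e (combine i v) then w e else 0
    other-copy : ∀ {i′} → i′ ≢ i → ∀ j → term (combine i′ j) ≡ 0
    other-copy {i′} i′≢i j = cong (if_then w (combine i′ j) else 0)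
      (trans (incident-copies i′ j (combine i v))
             (cong₂ _∨_ (⌊combine≟combine⌋-≢ i′≢i _ v) (⌊combine≟combine⌋-≢ i′≢i _ v)))
    same-copy : ∀ j → term (combine i j) ≡ (if incident G j v then w (combine i j) else 0)
    same-copy j = cong (if_then w (combine i j) else 0)
      (trans (incident-copies i j (combine i v))
             (cong₂ _∨_ (⌊combine≟combine⌋ i _ v) (⌊combine≟combine⌋ i _ v)))

  module _ (f : Fin (k * m) → Fin (k * m)) (c : Fin n → ℕ)
           (vsum≡c : ∀ (i : Fin k) v → vsum (copies k G) f (combine i v) ≡ c v) where

    copies-antimagic : (∀ j → c (proj₁ (ends G j)) ≢ c (proj₂ (ends G j))) →
      ∀ e → vsum (copies k G) f (proj₁ (ends (copies k G) e))
          ≢ vsum (copies k G) f (proj₂ (ends (copies k G) e))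
    copies-antimagic c-proper e eq =
      c-proper j (trans (sym (vsum≡c i _)) (trans eq (vsum≡c i _)))
      where
      i : Fin k
      i = proj₁ (remQuot {k} m e)
      j : Fin m
      j = proj₂ (remQuot {k} m e)

    vsum-copies∈ : ∀ {ys} → (∀ v → c v ∈ ys) → ∀ w → vsum (copies k G) f w ∈ ys
    vsum-copies∈ c∈ys w = subst (_∈ _)
      (trans (sym (vsum≡c i v)) (cong (vsum (copies k G) f) (combine-remQuot {k} n w)))
      (c∈ys v)
      where
      i : Fin k
      i = proj₁ (remQuot {k} n w)
      v : Fin n
      v = proj₂ (remQuot {k} n w)

Unique-⊆⇒length≤ : ∀ {a} {A : Set a} → DecidableEquality A →
  {xs ys : List A} → Unique xs → xs ⊆ ys → length xs ≤ length ys
Unique-⊆⇒length≤ _≟ᴬ_ {[]}     _             _     = z≤n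
Unique-⊆⇒length≤ _≟ᴬ_ {x ∷ xs} {ys} (x∉xs AllPairs.∷ xs!) xs⊆ys =
  ≤-trans (s≤s (Unique-⊆⇒length≤ _≟ᴬ_ xs! xs⊆ys-x))
          (filter-notAll (¬? ∘ (x ≟ᴬ_)) ys (Any.map (λ x≡y x≢y → x≢y x≡y) (xs⊆ys (here refl))))
  where
  xs⊆ys-x : xs ⊆ filter (¬? ∘ (x ≟ᴬ_)) ys
  xs⊆ys-x y∈xs = ∈-filter⁺ (¬? ∘ (x ≟ᴬ_)) (xs⊆ys (there y∈xs)) (All.lookup x∉xs y∈xs)

colours : Graph n m → (Fin m → Fin m) → List ℕ
colours G f = deduplicate _≟_ (map (vsum G f) (allFin _))

vsum∈colours : (G : Graph n m) (f : Fin m → Fin m) (v : Fin n) → vsum G f v ∈ colours G f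
vsum∈colours G f v = ∈-deduplicate⁺ _≟_ (∈-map⁺ (vsum G f) (∈-allFin v))

2≤numColours : (G : Graph n (suc m)) (f : Fin (suc m) → Fin (suc m)) →
  IsLocalAntimagic G f → 2 ≤ numColours G f
2≤numColours G f (_ , antimagic) =
  Unique-⊆⇒length≤ _≟_ ((antimagic 0F All.∷ All.[]) AllPairs.∷ All.[] AllPairs.∷ AllPairs.[]) λ
    { (here refl)         → vsum∈colours G f _
    ; (there (here refl)) → vsum∈colours G f _ }

numColours≤ : (G : Graph n m) (f : Fin m → Fin m) {ys : List ℕ} →
  (∀ v → vsum G f v ∈ ys) → numColours G f ≤ length ys
numColours≤ G f vsum∈ys =
  Unique-⊆⇒length≤ _≟_ (deduplicate-! _≟_ (map (vsum G f) (allFin _))) λ c∈colours →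
  let (v , _ , c≡vsum) = ∈-map⁻ (vsum G f) (∈-deduplicate⁻ _≟_ _ c∈colours)
  in subst (_∈ _) (sym c≡vsum) (vsum∈ys v)

opposite↔ : Fin n ↔ Fin n
opposite↔ = mk↔ₛ′ opposite opposite opposite-involutive opposite-involutive

cast↔ : m ≡ n → Fin m ↔ Fin n
cast↔ eq = mk↔ₛ′ (cast eq) (cast (sym eq)) (cast-involutive eq (sym eq)) (cast-involutive (sym eq) eq)

reversal : Bool → Fin n ↔ Fin n
reversal false = ↔-refl
reversal true  = opposite↔

toℕ-reversal : ∀ b (i : Fin n) →
  toℕ (Inverse.to (reversal b) i) ≡ (if b then toℕ (opposite i) else toℕ i)
toℕ-reversal false i = refl
toℕ-reversal true  i = refl

twist↔ : Fin m ↔ Fin m → (Fin m → Fin n ↔ Fin n) → (Fin n × Fin m) ↔ (Fin n × Fin m)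
twist↔ π σ = ×-comm _ _ ↔-∘ (Σ-↔ π (λ {j} → σ j) ↔-∘ ×-comm _ _)

cycleBlock : Fin 8 ↔ Fin 8
cycleBlock = mk↔ₛ′ to from to∘from from∘to
  where
  to from : Fin 8 → Fin 8
  to 0F = 0F ; to 1F = 2F ; to 2F = 5F ; to 3F = 6F
  to 4F = 1F ; to 5F = 3F ; to 6F = 4F ; to 7F = 7F
  from 0F = 0F ; from 1F = 4F ; from 2F = 1F ; from 3F = 5F
  from 4F = 6F ; from 5F = 2F ; from 6F = 3F ; from 7F = 7F
  to∘from : ∀ b → to (from b) ≡ b
  to∘from 0F = refl ; to∘from 1F = refl ; to∘from 2F = refl ; to∘from 3F = refl
  to∘from 4F = refl ; to∘from 5F = refl ; to∘from 6F = refl ; to∘from 7F = refl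
  from∘to : ∀ j → from (to j) ≡ j
  from∘to 0F = refl ; from∘to 1F = refl ; from∘to 2F = refl ; from∘to 3F = refl
  from∘to 4F = refl ; from∘to 5F = refl ; from∘to 6F = refl ; from∘to 7F = refl

cycleReversed : Fin 8 → Bool
cycleReversed 0F = false
cycleReversed 1F = false
cycleReversed 2F = true
cycleReversed 3F = false
cycleReversed 4F = true
cycleReversed 5F = true
cycleReversed 6F = false
cycleReversed 7F = true

chordReversed : Fin 2 → Bool
chordReversed 0F = true
chordReversed 1F = false

-- Edge j is uⱼ₊₁uⱼ₊₂ for j < 8, with block cycleBlock j, and xu₂, xu₆ for j = 8, 9. Labels
-- are counted from 0 here (label adds 1); reversal replaces copy i by opposite i = K - 1 - i.
module Labelling (K : ℕ) where

  open EquationalReasoning {k = bijection}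

  labels : (Fin K × (Fin 8 ⊎ Fin 2)) ↔ Fin (K * 10)
  labels =
    begin
      (Fin K × (Fin 8 ⊎ Fin 2))
        ↔⟨ ×-distribˡ-⊎ _ _ _ _ ⟩
      ((Fin K × Fin 8) ⊎ (Fin K × Fin 2))
        ↔⟨ (×-comm _ _ ↔-∘ twist↔ cycleBlock (reversal ∘ cycleReversed))
           ⊎-↔ twist↔ ↔-refl (reversal ∘ chordReversed) ⟩
      ((Fin 8 × Fin K) ⊎ (Fin K × Fin 2))
        ↔⟨ ↔-sym (*↔× ⊎-↔ *↔×) ⟩
      (Fin (8 * K) ⊎ Fin (K * 2))
        ↔⟨ ↔-sym +↔⊎ ⟩
      Fin (8 * K + K * 2)
        ↔⟨ cast↔ (trans (cong (_+ K * 2) (*-comm 8 K)) (sym (*-distribˡ-+ K 8 2))) ⟩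
      Fin (K * 10)
    ∎

  labelling : Fin (K * 10) ↔ Fin (K * 10)
  labelling =
    begin
      Fin (K * 10)                          ↔⟨ *↔× ⟩
      (Fin K × Fin 10)                      ↔⟨ ↔-refl ×-↔ +↔⊎ ⟩
      (Fin K × (Fin 8 ⊎ Fin 2))             ↔⟨ labels ⟩
      Fin (K * 10)
    ∎

  blockLabel : (a o : ℕ) → Fin 8 ⊎ Fin 2 → ℕ
  blockLabel a o = [ (λ j → K * toℕ (Inverse.to cycleBlock j) + (if cycleReversed j then o else a))
                   , (λ t → 8 * K + (2 * (if chordReversed t then o else a) + toℕ t)) ]′

  toℕ-labels : ∀ i s → toℕ (Inverse.to labels (i , s)) ≡ blockLabel (toℕ i) (toℕ (opposite i)) s
  toℕ-labels i (inj₁ j) =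
    trans (toℕ-cast _ (cycle ↑ˡ K * 2)) (trans (toℕ-↑ˡ cycle (K * 2)) (trans (toℕ-combine b p)
      (cong (K * toℕ b +_) (toℕ-reversal (cycleReversed j) i))))
    where
    b : Fin 8
    b = Inverse.to cycleBlock j
    p : Fin K
    p = Inverse.to (reversal (cycleReversed j)) i
    cycle : Fin (8 * K)
    cycle = combine b p
  toℕ-labels i (inj₂ t) =
    trans (toℕ-cast _ (8 * K ↑ʳ chord)) (trans (toℕ-↑ʳ (8 * K) chord) (cong (8 * K +_)
      (trans (toℕ-combine p t) (cong (λ p → 2 * p + toℕ t) (toℕ-reversal (chordReversed t) i)))))
    where
    p : Fin K
    p = Inverse.to (reversal (chordReversed t)) i
    chord : Fin (K * 2)
    chord = combine p t

  toℕ-labelling : ∀ i j → toℕ (Inverse.to labelling (combine i j))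
    ≡ blockLabel (toℕ i) (toℕ (opposite i)) (splitAt 8 j)
  toℕ-labelling i j =
    trans (cong (λ (i , j) → toℕ (Inverse.to labels (i , splitAt 8 j))) (remQuot-combine i j))
          (toℕ-labels i (splitAt 8 j))

toℕ+toℕ-opposite : (i : Fin (suc n)) → toℕ i + toℕ (opposite i) ≡ n
toℕ+toℕ-opposite {n} i = trans (cong (toℕ i +_) (opposite-prop i)) (m+[n∸m]≡n (toℕ≤pred[n] i))

colourValue : ℕ → Fin 4 → ℕ
colourValue K 0F = 8 * K + 1
colourValue K 1F = 12 * K + 1
colourValue K 2F = 14 * K + 2
colourValue K 3F = 18 * K + 1

colourClass : Fin 9 → Fin 4
colourClass 0F = 0F
colourClass 1F = 1F
colourClass 2F = 0F
colourClass 3F = 1F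
colourClass 4F = 0F
colourClass 5F = 2F
colourClass 6F = 0F
colourClass 7F = 1F
colourClass 8F = 3F

-- a and o stand for toℕ i and toℕ (opposite i) = K - 1 - i. The ring solver does not unfold
-- definitions, so each clause restates its goal in normal form: the labels at v in edge order.
C8*-vertexSum : ∀ {K} a o → suc (a + o) ≡ K → ∀ v →
  incidenceSum C8* (λ j → suc (Labelling.blockLabel K a o (splitAt 8 j))) v
    ≡ colourValue K (colourClass v)
C8*-vertexSum {K} a o refl 0F =
  (suc (K * 0 + a) + (suc (K * 7 + o) + 0) ≡ 8 * K + 1) ∋ solve (a ∷ o ∷ [])
C8*-vertexSum {K} a o refl 1F =
  (suc (K * 0 + a) + (suc (K * 2 + a) + (suc (8 * K + (2 * o + 0)) + 0)) ≡ 12 * K + 1) ∋ solve (a ∷ o ∷ [])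
C8*-vertexSum {K} a o refl 2F =
  (suc (K * 2 + a) + (suc (K * 5 + o) + 0) ≡ 8 * K + 1) ∋ solve (a ∷ o ∷ [])
C8*-vertexSum {K} a o refl 3F =
  (suc (K * 5 + o) + (suc (K * 6 + a) + 0) ≡ 12 * K + 1) ∋ solve (a ∷ o ∷ [])
C8*-vertexSum {K} a o refl 4F =
  (suc (K * 6 + a) + (suc (K * 1 + o) + 0) ≡ 8 * K + 1) ∋ solve (a ∷ o ∷ [])
C8*-vertexSum {K} a o refl 5F =
  (suc (K * 1 + o) + (suc (K * 3 + o) + (suc (8 * K + (2 * a + 1)) + 0)) ≡ 14 * K + 2) ∋ solve (a ∷ o ∷ [])
C8*-vertexSum {K} a o refl 6F =
  (suc (K * 3 + o) + (suc (K * 4 + a) + 0) ≡ 8 * K + 1) ∋ solve (a ∷ o ∷ [])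
C8*-vertexSum {K} a o refl 7F =
  (suc (K * 4 + a) + (suc (K * 7 + o) + 0) ≡ 12 * K + 1) ∋ solve (a ∷ o ∷ [])
C8*-vertexSum {K} a o refl 8F =
  (suc (8 * K + (2 * o + 0)) + (suc (8 * K + (2 * a + 1)) + 0) ≡ 18 * K + 1) ∋ solve (a ∷ o ∷ [])

<-by-gap : ∀ {x y} d → x + suc d ≡ y → x < y
<-by-gap {x} d refl = m<m+n x (s≤s z≤n)

module _ (n : ℕ) where

  colourValue₀<₁ : colourValue (suc n) 0F < colourValue (suc n) 1F
  colourValue₀<₁ = <-by-gap (3 + 4 * n) ((8 * suc n + 1 + suc (3 + 4 * n) ≡ 12 * suc n + 1) ∋ solve (n ∷ []))

  colourValue₀<₂ : colourValue (suc n) 0F < colourValue (suc n) 2F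
  colourValue₀<₂ = <-by-gap (6 + 6 * n) ((8 * suc n + 1 + suc (6 + 6 * n) ≡ 14 * suc n + 2) ∋ solve (n ∷ []))

  colourValue₁<₃ : colourValue (suc n) 1F < colourValue (suc n) 3F
  colourValue₁<₃ = <-by-gap (5 + 6 * n) ((12 * suc n + 1 + suc (5 + 6 * n) ≡ 18 * suc n + 1) ∋ solve (n ∷ []))

  colourValue₂<₃ : colourValue (suc n) 2F < colourValue (suc n) 3F
  colourValue₂<₃ = <-by-gap (2 + 4 * n) ((14 * suc n + 2 + suc (2 + 4 * n) ≡ 18 * suc n + 1) ∋ solve (n ∷ []))

  C8*-colouring-proper : ∀ j → colourValue (suc n) (colourClass (proj₁ (C8*ends j)))
                             ≢ colourValue (suc n) (colourClass (proj₂ (C8*ends j)))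
  C8*-colouring-proper 0F = <⇒≢ colourValue₀<₁
  C8*-colouring-proper 1F = >⇒≢ colourValue₀<₁
  C8*-colouring-proper 2F = <⇒≢ colourValue₀<₁
  C8*-colouring-proper 3F = >⇒≢ colourValue₀<₁
  C8*-colouring-proper 4F = <⇒≢ colourValue₀<₂
  C8*-colouring-proper 5F = >⇒≢ colourValue₀<₂
  C8*-colouring-proper 6F = <⇒≢ colourValue₀<₁
  C8*-colouring-proper 7F = >⇒≢ colourValue₀<₁
  C8*-colouring-proper 8F = >⇒≢ colourValue₁<₃
  C8*-colouring-proper 9F = >⇒≢ colourValue₂<₃

  private
    f : Fin (suc n * 10) → Fin (suc n * 10)
    f = Inverse.to (Labelling.labelling (suc n))

  vsum-labelling : (i : Fin (suc n)) (v : Fin 9) →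
    vsum (copies (suc n) C8*) f (combine i v) ≡ colourValue (suc n) (colourClass v)
  vsum-labelling i v = begin
    vsum (copies (suc n) C8*) f (combine i v)
      ≡⟨ incidenceSum-copies (suc n) C8* (label f) i v ⟩
    incidenceSum C8* (label f ∘ combine i) v
      ≡⟨ incidenceSum-cong C8* (cong suc ∘ toℕ-labelling i) v ⟩
    incidenceSum C8* (λ j → suc (blockLabel a o (splitAt 8 j))) v
      ≡⟨ C8*-vertexSum a o (cong suc (toℕ+toℕ-opposite i)) v ⟩
    colourValue (suc n) (colourClass v)
      ∎
    where
    open ≡-Reasoning
    open Labelling (suc n)
    a o : ℕ
    a = toℕ i
    o = toℕ (opposite i)

  labelling-isLocalAntimagic : IsLocalAntimagic (copies (suc n) C8*) f
  labelling-isLocalAntimagic =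
    Bijection.bijective (Inverse⇒Bijection (Labelling.labelling (suc n))) ,
    copies-antimagic (suc n) C8* f _ vsum-labelling C8*-colouring-proper

  labelling-numColours≤4 : numColours (copies (suc n) C8*) f ≤ 4
  labelling-numColours≤4 = numColours≤ (copies (suc n) C8*) f (vsum-copies∈ (suc n) C8* f _ vsum-labelling
    (λ v → ∈-map⁺ (colourValue (suc n)) (∈-allFin (colourClass v))))

theorem4p1 : (k : ℕ) → 1 ≤ k →
    ((f : Fin (k * 10) → Fin (k * 10)) → IsLocalAntimagic (copies k C8*) f →
       2 ≤ numColours (copies k C8*) f)
    × Σ (Fin (k * 10) → Fin (k * 10)) (λ f →
        IsLocalAntimagic (copies k C8*) f × numColours (copies k C8*) f ≤ 4)
theorem4p1 (suc n) _ =
  2≤numColours (copies (suc n) C8*) ,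
  (Inverse.to (Labelling.labelling (suc n)) , labelling-isLocalAntimagic n , labelling-numColours≤4 n)
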